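{- Let $d\geqslant 2$, $i\in[1,d-1]$, $x\geqslant 0$ be integers and let $0=b_1<b_2<\dots<b_d$ be natural integers. Then \[\binom{x,\ x+1,\dots,x+i-1,\ x+i+1,\dots,x+d}{0,\ b_2,\dots,b_i,\ b_{i+1},\dots,b_d} =\binom{x,\dots,x+i-2,\ x+i,\ x+i+1,\dots,x+d-1}{b_2-1,\dots,b_i-1,\ b_{i+1}-1,\dots,b_d-1} +\binom{x,\dots,x+i-2,\ x+i-1,\ x+i+1,\dots,x+d-1}{b_2-1,\dots,b_i-1,\ b_{i+1}-1,\dots,b_d-1}.\] Here the left side is a $d\times d$ binomial determinant whose top row is the integers $x,\dots,x+d$ with $x+i$ omitted; the first determinant on the right has top row the integers $x,\dots,x+d-1$ with $x+i-1$ omitted, and the second has top row the integers $x,\dots,x+d-1$ with $x+i$ omitted (both of size $(d-1)\times(d-1)$).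
   Context: For natural integers $a_1,\dots,a_n$ and $c_1,\dots,c_n$, the binomial determinant $\binom{a_1,\dots,a_n}{c_1,\dots,c_n}$ denotes $\det\left(\binom{a_r}{c_s}\right)_{1\leqslant r,s\leqslant n}$, with $\binom{a}{c}=0$ if $c>a$. -}

module Defs where

open import Data.Nat as ℕ using (ℕ; zero; suc; _+_; _∸_; _<ᵇ_)
open import Data.Nat.Combinatorics using (_C_)
open import Data.Fin using (Fin; zero; suc; toℕ; punchIn)
open import Data.Integer as ℤ using (ℤ; +_)
open import Data.Bool using (if_then_else_)

sgn : ℕ → ℤ
sgn zero = ℤ.+ 1
sgn (suc k) = ℤ.- sgn k

Σ : ∀ {n} → (Fin n → ℤ) → ℤ
Σ {zero} f = ℤ.+ 0
Σ {suc n} f = f zero ℤ.+ Σ (λ j → f (suc j))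

det : ∀ n → (Fin n → Fin n → ℤ) → ℤ
det zero M = ℤ.+ 1
det (suc n) M =
  Σ (λ j → sgn (toℕ j) ℤ.* (M zero j ℤ.* det n (λ r s → M (suc r) (punchIn j s))))

-- binomial determinant ( a_1,...,a_n ; c_1,...,c_n ) = det ( binom(a_r, c_s) )
-- (binom a c = 0 when c > a, which is the behaviour of _C_)
binomDet : ∀ n → (Fin n → ℕ) → (Fin n → ℕ) → ℤ
binomDet n a c = det n (λ r s → + (a r C c s))

-- the list x, x+1, ..., x+m with x+i omitted, indexed by Fin m (0-based):
-- entry r is x+r if r < i, and x+r+1 otherwise
omitRow : ∀ m → ℕ → ℕ → Fin m → ℕ
omitRow m x i r = if toℕ r <ᵇ i then x + toℕ r else x + suc (toℕ r)

-- Since b₁ = 0, the first column of the left-hand matrix consists of ones.  Subtracting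
-- from every row the previous one does not change the determinant (which vanishes on
-- matrices with two equal rows), and expanding along the first column then leaves the
-- matrix of differences C(a_{r+1}, b_s) − C(a_r, b_s) of consecutive top entries.  By
-- Pascal's rule this entry is C(a_r, b_s − 1) when a_{r+1} = a_r + 1, and it is
-- C(a_r + 1, b_s − 1) + C(a_r, b_s − 1) in the one row where the top row jumps over x+i;
-- linearity of the determinant in that row gives the two determinants on the right.
-- That the Laplace-expansion determinant vanishes on two equal rows follows from the
-- antisymmetry of the simultaneous expansion along the first two rows, proved by
-- induction by splitting off the terms that use column 0.

module Submission where

open import Defs
open import Data.Nat using (ℕ; zero; suc; _≤_; _∸_)
open import Data.Fin using (Fin; zero; suc)
open import Data.Fin as F using ()
open import Data.Nat as N using ()
open import Data.Integer using (_+_)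
open import Relation.Binary.PropositionalEquality using (_≡_)

open import Data.Bool using (true; false)
open import Data.Empty using (⊥-elim)
open import Data.Fin using (toℕ; punchIn; inject₁; fromℕ<)
open import Data.Fin.Properties using (suc-injective; toℕ-inject₁; toℕ-fromℕ<; toℕ-injective)
open import Data.Integer using (ℤ; +_; _*_; -_; _-_; +[1+_]; -[1+_])
open import Data.Integer.Properties
  using (*-zeroʳ; *-identityˡ; +-identityʳ; *-distribˡ-+; neg-distrib-+; neg-distribˡ-*; +-minus-telescope; pos-+; +-commutativeSemigroup)
open import Data.Integer.Tactic.RingSolver using (solve-∀)
open import Data.Nat.Combinatorics using (_C_; nCk+nC[k+1]≡[n+1]C[k+1])
open import Data.Nat.Properties as ℕ using (<ᵇ-reflects-<)
open import Algebra.Properties.CommutativeSemigroup +-commutativeSemigroup using (interchange)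
open import Function using (_∘_)
open import Relation.Binary.Core using (_Preserves_⟶_)
open import Relation.Binary.Definitions using (tri<; tri≈; tri>)
open import Relation.Binary.PropositionalEquality
  using (_≢_; _≗_; refl; sym; trans; cong; cong₂; module ≡-Reasoning)
open import Relation.Nullary.Reflects using (ofʸ; ofⁿ)

open ≡-Reasoning

Σ-cong : ∀ {n} {f g : Fin n → ℤ} → f ≗ g → Σ f ≡ Σ g
Σ-cong {zero} f≗g = refl
Σ-cong {suc n} f≗g = cong₂ _+_ (f≗g zero) (Σ-cong (f≗g ∘ suc))

Σ-+ : ∀ {n} (f g : Fin n → ℤ) → Σ (λ j → f j + g j) ≡ Σ f + Σ g
Σ-+ {zero} f g = refl
Σ-+ {suc n} f g = trans (cong (_+_ (f zero + g zero)) (Σ-+ (f ∘ suc) (g ∘ suc)))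
                        (interchange (f zero) (g zero) (Σ (f ∘ suc)) (Σ (g ∘ suc)))

Σ-*ˡ : ∀ {n} c (f : Fin n → ℤ) → Σ (λ j → c * f j) ≡ c * Σ f
Σ-*ˡ {zero} c f = sym (*-zeroʳ c)
Σ-*ˡ {suc n} c f = trans (cong (_+_ (c * f zero)) (Σ-*ˡ c (f ∘ suc)))
                         (sym (*-distribˡ-+ c (f zero) (Σ (f ∘ suc))))

Σ-neg : ∀ {n} (f : Fin n → ℤ) → Σ (λ j → - f j) ≡ - Σ f
Σ-neg {zero} f = refl
Σ-neg {suc n} f = trans (cong (_+_ (- f zero)) (Σ-neg (f ∘ suc)))
                        (sym (neg-distrib-+ (f zero) (Σ (f ∘ suc))))

Σ-zero : ∀ {n} {f : Fin n → ℤ} → (∀ j → f j ≡ + 0) → Σ f ≡ + 0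
Σ-zero {zero} f≡0 = refl
Σ-zero {suc n} f≡0 = cong₂ _+_ (f≡0 zero) (Σ-zero (f≡0 ∘ suc))

expandRow : ∀ {n} → (Fin n → ℤ) → (Fin n → ℤ) → ℤ
expandRow a d = Σ λ j → sgn (toℕ j) * (a j * d j)

expandRow-cong : ∀ {n} {a a′ d d′ : Fin n → ℤ} → a ≗ a′ → d ≗ d′ → expandRow a d ≡ expandRow a′ d′
expandRow-cong a≗a′ d≗d′ = Σ-cong λ j → cong₂ (λ x y → sgn (toℕ j) * (x * y)) (a≗a′ j) (d≗d′ j)

expandRow-+ˡ : ∀ {n} (a b d : Fin n → ℤ) → expandRow (λ j → a j + b j) d ≡ expandRow a d + expandRow b d
expandRow-+ˡ a b d = trans (Σ-cong λ j → distrib (sgn (toℕ j)) (a j) (b j) (d j))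
  (Σ-+ (λ j → sgn (toℕ j) * (a j * d j)) (λ j → sgn (toℕ j) * (b j * d j)))
  where
  distrib : ∀ e x y z → e * ((x + y) * z) ≡ e * (x * z) + e * (y * z)
  distrib = solve-∀

expandRow-+ʳ : ∀ {n} (a d e : Fin n → ℤ) → expandRow a (λ j → d j + e j) ≡ expandRow a d + expandRow a e
expandRow-+ʳ a d e = trans (Σ-cong λ j → distrib (sgn (toℕ j)) (a j) (d j) (e j))
  (Σ-+ (λ j → sgn (toℕ j) * (a j * d j)) (λ j → sgn (toℕ j) * (a j * e j)))
  where
  distrib : ∀ s x y z → s * (x * (y + z)) ≡ s * (x * y) + s * (x * z)
  distrib = solve-∀

expandRow-negʳ : ∀ {n} (a d : Fin n → ℤ) → expandRow a (λ j → - d j) ≡ - expandRow a d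
expandRow-negʳ a d = trans (Σ-cong λ j → pull (sgn (toℕ j)) (a j) (d j))
  (Σ-neg (λ j → sgn (toℕ j) * (a j * d j)))
  where
  pull : ∀ s x y → s * (x * - y) ≡ - (s * (x * y))
  pull = solve-∀

expandRow-*ʳ : ∀ {n} (a : Fin n → ℤ) c (d : Fin n → ℤ) → expandRow a (λ j → c * d j) ≡ c * expandRow a d
expandRow-*ʳ a c d = trans (Σ-cong λ j → pull (sgn (toℕ j)) (a j) c (d j))
  (Σ-*ˡ c (λ j → sgn (toℕ j) * (a j * d j)))
  where
  pull : ∀ s x c y → s * (x * (c * y)) ≡ c * (s * (x * y))
  pull = solve-∀

expandRow-zeroʳ : ∀ {n} (a : Fin n → ℤ) → expandRow a (λ _ → + 0) ≡ + 0
expandRow-zeroʳ a = Σ-zero λ j → trans (cong (sgn (toℕ j) *_) (*-zeroʳ (a j))) (*-zeroʳ (sgn (toℕ j)))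

expandRow-suc : ∀ {n} (a d : Fin (suc n) → ℤ) → expandRow a d ≡ a zero * d zero - expandRow (a ∘ suc) (d ∘ suc)
expandRow-suc a d = cong₂ _+_ (*-identityˡ (a zero * d zero))
  (trans (Σ-cong λ j → sym (neg-distribˡ-* (sgn (toℕ j)) (a (suc j) * d (suc j))))
         (Σ-neg (λ j → sgn (toℕ j) * (a (suc j) * d (suc j)))))

Matrix : ℕ → Set
Matrix n = Fin n → Fin n → ℤ

minor : ∀ {n} → Matrix (suc n) → Fin (suc n) → Matrix n
minor M j r s = M (suc r) (punchIn j s)

det-cong : ∀ n {M M′ : Matrix n} → (∀ r → M r ≗ M′ r) → det n M ≡ det n M′
det-cong zero M≗M′ = refl
det-cong (suc n) M≗M′ = expandRow-cong (M≗M′ zero) λ j → det-cong n λ r s → M≗M′ (suc r) (punchIn j s)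

det-row-additive : ∀ n (k : Fin n) (A B M : Matrix n)
  → (∀ s → M k s ≡ A k s + B k s)
  → (∀ r → r ≢ k → A r ≗ M r) → (∀ r → r ≢ k → B r ≗ M r)
  → det n M ≡ det n A + det n B
det-row-additive (suc n) zero A B M Mₖ A≗M B≗M = begin
  expandRow (M zero) (det n ∘ minor M)                                 ≡⟨ expandRow-cong {d = det n ∘ minor M} Mₖ (λ _ → refl) ⟩
  expandRow (λ j → A zero j + B zero j) (det n ∘ minor M)              ≡⟨ expandRow-+ˡ (A zero) (B zero) (det n ∘ minor M) ⟩
  expandRow (A zero) (det n ∘ minor M) + expandRow (B zero) (det n ∘ minor M)
    ≡⟨ sym (cong₂ _+_ (expandRow-cong {a = A zero} (λ _ → refl) (minors-agree A A≗M))
                      (expandRow-cong {a = B zero} (λ _ → refl) (minors-agree B B≗M))) ⟩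
  det (suc n) A + det (suc n) B ∎
  where
  minors-agree : ∀ X → (∀ r → r ≢ zero → X r ≗ M r) → ∀ j → det n (minor X j) ≡ det n (minor M j)
  minors-agree X X≗M j = det-cong n λ r s → X≗M (suc r) (λ ()) (punchIn j s)
det-row-additive (suc n) (suc k) A B M Mₖ A≗M B≗M = begin
  expandRow (M zero) (det n ∘ minor M)                                 ≡⟨ expandRow-cong {a = M zero} (λ _ → refl) minors-additive ⟩
  expandRow (M zero) (λ j → det n (minor A j) + det n (minor B j))     ≡⟨ expandRow-+ʳ (M zero) (det n ∘ minor A) (det n ∘ minor B) ⟩
  expandRow (M zero) (det n ∘ minor A) + expandRow (M zero) (det n ∘ minor B)
    ≡⟨ sym (cong₂ _+_ (expandRow-cong {d = det n ∘ minor A} (A≗M zero (λ ())) (λ _ → refl))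
                      (expandRow-cong {d = det n ∘ minor B} (B≗M zero (λ ())) (λ _ → refl))) ⟩
  det (suc n) A + det (suc n) B ∎
  where
  minors-additive : ∀ j → det n (minor M j) ≡ det n (minor A j) + det n (minor B j)
  minors-additive j = det-row-additive n k (minor A j) (minor B j) (minor M j) (Mₖ ∘ punchIn j)
    (λ r r≢k s → A≗M (suc r) (r≢k ∘ suc-injective) (punchIn j s))
    (λ r r≢k s → B≗M (suc r) (r≢k ∘ suc-injective) (punchIn j s))

Columns : ℕ → ℕ → Set
Columns k m = Fin k → Fin m

-- Laplace expansion along two rows v and w; F c stands for the determinant of
-- the remaining k rows restricted to the columns selected by c.
expand₂ : ∀ k → (Columns k (suc (suc k)) → ℤ) → (v w : Fin (suc (suc k)) → ℤ) → ℤ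
expand₂ k F v w = expandRow v λ j → expandRow (w ∘ punchIn j) λ l → F (punchIn j ∘ punchIn l)

cofactor₀₀ : ∀ k → (Columns k (suc (suc k)) → ℤ) → (Fin (suc (suc k)) → ℤ) → ℤ
cofactor₀₀ k F w = expandRow (w ∘ suc) λ l → F (suc ∘ punchIn l)

expand₂-avoiding₀ : ∀ k → (Columns k (suc (suc k)) → ℤ) → (v w : Fin (suc (suc k)) → ℤ) → ℤ
expand₂-avoiding₀ k F v w =
  expandRow (v ∘ suc) λ j → expandRow (w ∘ suc ∘ punchIn j) λ l → F (punchIn (suc j) ∘ punchIn (suc l))

expand₂-split : ∀ k F v w → expand₂ k F v w
  ≡ v zero * cofactor₀₀ k F w - (w zero * cofactor₀₀ k F v - expand₂-avoiding₀ k F v w)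
expand₂-split k F v w = begin
  expand₂ k F v w
    ≡⟨ expandRow-suc v inner ⟩
  v zero * cofactor₀₀ k F w - expandRow (v ∘ suc) (λ j → inner (suc j))
    ≡⟨ cong (λ z → v zero * cofactor₀₀ k F w - z) (begin
         expandRow (v ∘ suc) (λ j → inner (suc j))
           ≡⟨ expandRow-cong {a = v ∘ suc} (λ _ → refl) (λ j → expandRow-suc (w ∘ punchIn (suc j)) (λ l → F (punchIn (suc j) ∘ punchIn l))) ⟩
         expandRow (v ∘ suc) (λ j → w zero * first j + - rest j)
           ≡⟨ expandRow-+ʳ (v ∘ suc) (λ j → w zero * first j) (λ j → - rest j) ⟩
         expandRow (v ∘ suc) (λ j → w zero * first j) + expandRow (v ∘ suc) (λ j → - rest j)
           ≡⟨ cong₂ _+_ (expandRow-*ʳ (v ∘ suc) (w zero) first) (expandRow-negʳ (v ∘ suc) rest) ⟩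
         w zero * cofactor₀₀ k F v - expand₂-avoiding₀ k F v w ∎) ⟩
  v zero * cofactor₀₀ k F w - (w zero * cofactor₀₀ k F v - expand₂-avoiding₀ k F v w) ∎
  where
  inner : Fin (suc (suc k)) → ℤ
  inner j = expandRow (w ∘ punchIn j) λ l → F (punchIn j ∘ punchIn l)
  first rest : Fin (suc k) → ℤ
  first j = F (suc ∘ punchIn j)
  rest j = expandRow (w ∘ suc ∘ punchIn j) λ l → F (punchIn (suc j) ∘ punchIn (suc l))

expand₂-avoiding₀-zero : ∀ F v w → expand₂-avoiding₀ zero F v w ≡ + 0
expand₂-avoiding₀-zero F v w = expandRow-zeroʳ (v ∘ suc)

expand₂-avoiding₀-suc : ∀ k {F} → F Preserves _≗_ ⟶ _≡_ → ∀ v w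
  → expand₂-avoiding₀ (suc k) F v w ≡ expand₂ k (F ∘ F.lift 1) (v ∘ suc) (w ∘ suc)
expand₂-avoiding₀-suc k F-ext v w =
  expandRow-cong {a = v ∘ suc} (λ _ → refl) λ j → expandRow-cong {a = w ∘ suc ∘ punchIn j} (λ _ → refl) λ l →
    F-ext {punchIn (suc j) ∘ punchIn (suc l)} {F.lift 1 (punchIn j ∘ punchIn l)} λ { zero → refl ; (suc s) → refl }

lift-preserves-≗ : ∀ {k m} {F : Columns (suc k) (suc m) → ℤ} → F Preserves _≗_ ⟶ _≡_
  → (F ∘ F.lift 1) Preserves _≗_ ⟶ _≡_
lift-preserves-≗ F-ext c≗c′ = F-ext λ { zero → refl ; (suc s) → cong suc (c≗c′ s) }

antisym-from-avoiding₀ : ∀ k F v w → expand₂-avoiding₀ k F v w ≡ - expand₂-avoiding₀ k F w v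
  → expand₂ k F v w ≡ - expand₂ k F w v
antisym-from-avoiding₀ k F v w t≡-t = begin
  expand₂ k F v w
    ≡⟨ expand₂-split k F v w ⟩
  v zero * cofactor₀₀ k F w - (w zero * cofactor₀₀ k F v - expand₂-avoiding₀ k F v w)
    ≡⟨ cong (λ t → v zero * cofactor₀₀ k F w - (w zero * cofactor₀₀ k F v - t)) t≡-t ⟩
  v zero * cofactor₀₀ k F w - (w zero * cofactor₀₀ k F v - - expand₂-avoiding₀ k F w v)
    ≡⟨ swap (v zero) (cofactor₀₀ k F w) (w zero) (cofactor₀₀ k F v) (expand₂-avoiding₀ k F w v) ⟩
  - (w zero * cofactor₀₀ k F v - (v zero * cofactor₀₀ k F w - expand₂-avoiding₀ k F w v))
    ≡⟨ cong -_ (sym (expand₂-split k F w v)) ⟩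
  - expand₂ k F w v ∎
  where
  swap : ∀ a b c d t → a * b - (c * d - - t) ≡ - (c * d - (a * b - t))
  swap = solve-∀

expand₂-antisym : ∀ k {F} → F Preserves _≗_ ⟶ _≡_ → ∀ v w → expand₂ k F v w ≡ - expand₂ k F w v
expand₂-antisym zero {F} _ v w = antisym-from-avoiding₀ zero F v w
  (trans (expand₂-avoiding₀-zero F v w) (cong -_ (sym (expand₂-avoiding₀-zero F w v))))
expand₂-antisym (suc k) {F} F-ext v w = antisym-from-avoiding₀ (suc k) F v w (begin
  expand₂-avoiding₀ (suc k) F v w                 ≡⟨ expand₂-avoiding₀-suc k F-ext v w ⟩
  expand₂ k (F ∘ F.lift 1) (v ∘ suc) (w ∘ suc)     ≡⟨ expand₂-antisym k (lift-preserves-≗ F-ext) (v ∘ suc) (w ∘ suc) ⟩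
  - expand₂ k (F ∘ F.lift 1) (w ∘ suc) (v ∘ suc)   ≡⟨ cong -_ (sym (expand₂-avoiding₀-suc k F-ext w v)) ⟩
  - expand₂-avoiding₀ (suc k) F w v ∎)

i≡-i⇒i≡0 : ∀ {i} → i ≡ - i → i ≡ + 0
i≡-i⇒i≡0 {+ zero} _ = refl
i≡-i⇒i≡0 {+[1+ n ]} ()
i≡-i⇒i≡0 { -[1+ n ]} ()

det-equal-first-rows : ∀ k (M : Matrix (suc (suc k))) → M zero ≗ M (suc zero) → det (suc (suc k)) M ≡ + 0
det-equal-first-rows k M M₀≗M₁ = begin
  det (suc (suc k)) M          ≡⟨ expandRow-cong {a = M zero} (λ _ → refl) (λ j →
                                    expandRow-cong {d = λ l → F (punchIn j ∘ punchIn l)} (sym ∘ M₀≗M₁ ∘ punchIn j) (λ _ → refl)) ⟩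
  expand₂ k F (M zero) (M zero) ≡⟨ i≡-i⇒i≡0 (expand₂-antisym k F-ext (M zero) (M zero)) ⟩
  + 0 ∎
  where
  F : Columns k (suc (suc k)) → ℤ
  F c = det k λ r s → M (suc (suc r)) (c s)
  F-ext : F Preserves _≗_ ⟶ _≡_
  F-ext c≗c′ = det-cong k λ r s → cong (M (suc (suc r))) (c≗c′ s)

rowDifferences : ∀ {n} → Matrix (suc n) → Matrix (suc n)
rowDifferences P zero = P zero
rowDifferences P (suc r) s = P (suc r) s - P (inject₁ r) s

det-rowDifferences : ∀ n (P : Matrix (suc n)) → det (suc n) (rowDifferences P) ≡ det (suc n) P
det-rowDifferences zero P = refl
det-rowDifferences (suc n) P = begin
  expandRow (P zero) (det (suc n) ∘ minor (rowDifferences P))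
    ≡⟨ expandRow-cong {a = P zero} (λ _ → refl) minor-rowDifferences ⟩
  expandRow (P zero) (λ j → det (suc n) (minor P j) + - det (suc n) (minor W j))
    ≡⟨ expandRow-+ʳ (P zero) (det (suc n) ∘ minor P) (λ j → - det (suc n) (minor W j)) ⟩
  det (suc (suc n)) P + expandRow (P zero) (λ j → - det (suc n) (minor W j))
    ≡⟨ cong (_+_ (det (suc (suc n)) P)) (expandRow-negʳ (P zero) (det (suc n) ∘ minor W)) ⟩
  det (suc (suc n)) P - det (suc (suc n)) W
    ≡⟨ cong (λ d → det (suc (suc n)) P - d) (det-equal-first-rows n W (λ _ → refl)) ⟩
  det (suc (suc n)) P - + 0
    ≡⟨ +-identityʳ _ ⟩
  det (suc (suc n)) P ∎
  where
  -- minor (rowDifferences P) j is rowDifferences (minor P j) with P zero subtracted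
  -- from its first row; the subtracted parts are the minors of W, whose first two
  -- rows are both P zero.
  W : Matrix (suc (suc n))
  W zero = P zero
  W (suc zero) = P zero
  W (suc (suc r)) = rowDifferences P (suc (suc r))
  sub-add : ∀ a b → a ≡ (a - b) + b
  sub-add = solve-∀
  add-sub : ∀ a b → a ≡ (a + b) - b
  add-sub = solve-∀
  minor-rowDifferences : ∀ j → det (suc n) (minor (rowDifferences P) j) ≡ det (suc n) (minor P j) + - det (suc n) (minor W j)
  minor-rowDifferences j = begin
    det (suc n) (minor (rowDifferences P) j)
      ≡⟨ add-sub _ (det (suc n) (minor W j)) ⟩
    det (suc n) (minor (rowDifferences P) j) + det (suc n) (minor W j) - det (suc n) (minor W j)
      ≡⟨ cong (_- det (suc n) (minor W j)) (sym (det-row-additive (suc n) zero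
           (minor (rowDifferences P) j) (minor W j) (rowDifferences (minor P j))
           (λ s → sub-add (P (suc zero) (punchIn j s)) (P zero (punchIn j s)))
           (λ { zero 0≢0 → ⊥-elim (0≢0 refl) ; (suc r) _ _ → refl })
           (λ { zero 0≢0 → ⊥-elim (0≢0 refl) ; (suc r) _ _ → refl }))) ⟩
    det (suc n) (rowDifferences (minor P j)) - det (suc n) (minor W j)
      ≡⟨ cong (_- det (suc n) (minor W j)) (det-rowDifferences n (minor P j)) ⟩
    det (suc n) (minor P j) - det (suc n) (minor W j) ∎

mutual
  det-zero-first-column : ∀ n (M : Matrix (suc n)) → (∀ r → M r zero ≡ + 0) → det (suc n) M ≡ + 0
  det-zero-first-column n M M₀≡0 =
    trans (det-pivot n M (M₀≡0 ∘ suc)) (cong (_* det n (minor M zero)) (M₀≡0 zero))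

  det-pivot : ∀ n (M : Matrix (suc n)) → (∀ r → M (suc r) zero ≡ + 0)
    → det (suc n) M ≡ M zero zero * det n (minor M zero)
  det-pivot n M below≡0 = begin
    det (suc n) M
      ≡⟨ expandRow-suc (M zero) (det n ∘ minor M) ⟩
    M zero zero * det n (minor M zero) - expandRow (M zero ∘ suc) (λ j → det n (minor M (suc j)))
      ≡⟨ cong (λ t → M zero zero * det n (minor M zero) - t)
              (trans (expandRow-cong {a = M zero ∘ suc} (λ _ → refl) (minors-vanish n M below≡0))
                     (expandRow-zeroʳ (M zero ∘ suc))) ⟩
    M zero zero * det n (minor M zero) - + 0
      ≡⟨ +-identityʳ _ ⟩
    M zero zero * det n (minor M zero) ∎
    where
    minors-vanish : ∀ n (M : Matrix (suc n)) → (∀ r → M (suc r) zero ≡ + 0)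
      → ∀ j → det n (minor M (suc j)) ≡ + 0
    minors-vanish (suc n) M below≡0 j = det-zero-first-column n (minor M (suc j)) below≡0

det-unit-first-column : ∀ n (M : Matrix (suc n)) → (∀ r → M r zero ≡ + 1)
  → det (suc n) M ≡ det n (minor (rowDifferences M) zero)
det-unit-first-column n M M₀≡1 = begin
  det (suc n) M
    ≡⟨ sym (det-rowDifferences n M) ⟩
  det (suc n) (rowDifferences M)
    ≡⟨ det-pivot n (rowDifferences M) (λ r → cong₂ _-_ (M₀≡1 (suc r)) (M₀≡1 (inject₁ r))) ⟩
  M zero zero * det n (minor (rowDifferences M) zero)
    ≡⟨ cong (_* det n (minor (rowDifferences M) zero)) (M₀≡1 zero) ⟩
  + 1 * det n (minor (rowDifferences M) zero)
    ≡⟨ *-identityˡ _ ⟩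
  det n (minor (rowDifferences M) zero) ∎

pascal-step : ∀ {p q} c → p ≡ q → + (suc p C suc c) - + (q C suc c) ≡ + (p C c)
pascal-step {p} c refl = begin
  + (suc p C suc c) - + (p C suc c)              ≡⟨ cong (λ m → + m - + (p C suc c)) (sym (nCk+nC[k+1]≡[n+1]C[k+1] p c)) ⟩
  + (p C c N.+ p C suc c) - + (p C suc c)        ≡⟨ cong (_- + (p C suc c)) (pos-+ (p C c) (p C suc c)) ⟩
  + (p C c) + + (p C suc c) - + (p C suc c)      ≡⟨ cancel (+ (p C c)) (+ (p C suc c)) ⟩
  + (p C c) ∎
  where
  cancel : ∀ a b → a + b - b ≡ a
  cancel = solve-∀

pascal-step₂ : ∀ {p q} c → p ≡ suc q → + (suc p C suc c) - + (q C suc c) ≡ + (p C c) + + (q C c)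
pascal-step₂ {p} {q} c refl = begin
  + (suc p C suc c) - + (q C suc c)                                   ≡⟨ sym (+-minus-telescope (+ (suc p C suc c)) (+ (p C suc c)) (+ (q C suc c))) ⟩
  (+ (suc p C suc c) - + (p C suc c)) + (+ (p C suc c) - + (q C suc c)) ≡⟨ cong₂ _+_ (pascal-step c refl) (pascal-step c refl) ⟩
  + (p C c) + + (q C c) ∎

omitRow-below : ∀ m x i (r : Fin m) → toℕ r N.< i → omitRow m x i r ≡ x N.+ toℕ r
omitRow-below m x i r r<i with toℕ r N.<ᵇ i | <ᵇ-reflects-< (toℕ r) i
... | true  | _       = refl
... | false | ofⁿ r≮i = ⊥-elim (r≮i r<i)

omitRow-above : ∀ m x i (r : Fin m) → i ≤ toℕ r → omitRow m x i r ≡ x N.+ suc (toℕ r)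
omitRow-above m x i r i≤r with toℕ r N.<ᵇ i | <ᵇ-reflects-< (toℕ r) i
... | false | _       = refl
... | true  | ofʸ r<i = ⊥-elim (ℕ.<⇒≱ r<i i≤r)

omitRow-inject₁ : ∀ m x i (r : Fin m) → omitRow (suc m) x i (inject₁ r) ≡ omitRow m x i r
omitRow-inject₁ m x i r rewrite toℕ-inject₁ r = refl

omitRow-suc : ∀ m x i (r : Fin m) → omitRow (suc m) x (suc i) (suc r) ≡ suc (omitRow m x i r)
omitRow-suc m x i r with toℕ r N.<ᵇ i
... | true  = ℕ.+-suc x (toℕ r)
... | false = ℕ.+-suc x (suc (toℕ r))

omitRow-off : ∀ m x i (r : Fin m) → toℕ r ≢ i → omitRow m x i r ≡ omitRow m x (suc i) r
omitRow-off m x i r r≢i with ℕ.<-cmp (toℕ r) i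
... | tri< r<i _ _ = trans (omitRow-below m x i r r<i) (sym (omitRow-below m x (suc i) r (ℕ.m<n⇒m<1+n r<i)))
... | tri≈ _ r≡i _ = ⊥-elim (r≢i r≡i)
... | tri> _ _ i<r = trans (omitRow-above m x i r (ℕ.<⇒≤ i<r)) (sym (omitRow-above m x (suc i) r i<r))

omitRow-at : ∀ m x i (r : Fin m) → toℕ r ≡ i → omitRow m x i r ≡ suc (omitRow m x (suc i) r)
omitRow-at m x _ r refl = begin
  omitRow m x (toℕ r) r          ≡⟨ omitRow-above m x (toℕ r) r ℕ.≤-refl ⟩
  x N.+ suc (toℕ r)              ≡⟨ ℕ.+-suc x (toℕ r) ⟩
  suc (x N.+ toℕ r)              ≡⟨ cong suc (sym (omitRow-below m x (suc (toℕ r)) r (ℕ.n<1+n (toℕ r)))) ⟩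
  suc (omitRow m x (suc (toℕ r)) r) ∎

binomDifference : ∀ {n} → (Fin (suc n) → ℕ) → ℕ → Fin n → ℤ
binomDifference a c r = + (a (suc r) C c) - + (a (inject₁ r) C c)

binomDifference-omitRow : ∀ n x i c (r : Fin n) → binomDifference (omitRow (suc n) x (suc i)) c r
  ≡ + (suc (omitRow n x i r) C c) - + (omitRow n x (suc i) r C c)
binomDifference-omitRow n x i c r =
  cong₂ (λ p q → + (p C c) - + (q C c)) (omitRow-suc n x i r) (omitRow-inject₁ n x (suc i) r)

binomDifference-at : ∀ n x i c (r : Fin n) → toℕ r ≡ i → binomDifference (omitRow (suc n) x (suc i)) (suc c) r
  ≡ + (omitRow n x i r C c) + + (omitRow n x (suc i) r C c)
binomDifference-at n x i c r r≡i =
  trans (binomDifference-omitRow n x i (suc c) r) (pascal-step₂ c (omitRow-at n x i r r≡i))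

binomDifference-off : ∀ n x i c (r : Fin n) → toℕ r ≢ i → binomDifference (omitRow (suc n) x (suc i)) (suc c) r
  ≡ + (omitRow n x i r C c)
binomDifference-off n x i c r r≢i =
  trans (binomDifference-omitRow n x i (suc c) r) (pascal-step c (omitRow-off n x i r r≢i))

lemma3 : (n : ℕ) → 1 ≤ n → (i : ℕ) → 1 ≤ i → i ≤ n → (x : ℕ)
    → (b : Fin (suc n) → ℕ) → b zero ≡ 0
    → (∀ (j k : Fin (suc n)) → j F.< k → b j N.< b k)
    → binomDet (suc n) (omitRow (suc n) x i) b
    ≡ binomDet n (omitRow n x (i ∸ 1)) (λ s → b (suc s) ∸ 1)
    + binomDet n (omitRow n x i) (λ s → b (suc s) ∸ 1)
-- 1 ≤ n is implied by 1 ≤ i ≤ n.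
lemma3 n _ (suc i) _ i<n x b b₀≡0 b-increasing = begin
  binomDet (suc n) a b                               ≡⟨ det-unit-first-column n M (λ r → cong (λ c → + (a r C c)) b₀≡0) ⟩
  det n (minor (rowDifferences M) zero)              ≡⟨ det-row-additive n k R₁ R₂ _ gap-row R₁-off R₂-off ⟩
  binomDet n (omitRow n x i) c + binomDet n (omitRow n x (suc i)) c ∎
  where
  a : Fin (suc n) → ℕ
  a = omitRow (suc n) x (suc i)
  M : Matrix (suc n)
  M r s = + (a r C b s)
  c : Fin n → ℕ
  c s = b (suc s) ∸ 1
  R₁ R₂ : Matrix n
  R₁ r s = + (omitRow n x i r C c s)
  R₂ r s = + (omitRow n x (suc i) r C c s)
  k : Fin n
  k = fromℕ< i<n
  b-suc : ∀ s → b (suc s) ≡ suc (c s)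
  b-suc s with b (suc s) | b-increasing zero (suc s) N.z<s
  ... | suc _ | _ = refl
  entry : ∀ r s → minor (rowDifferences M) zero r s ≡ binomDifference a (suc (c s)) r
  entry r s = cong (λ d → binomDifference a d r) (b-suc s)
  gap-row : ∀ s → binomDifference a (b (suc s)) k ≡ R₁ k s + R₂ k s
  gap-row s = trans (entry k s) (binomDifference-at n x i (c s) k (toℕ-fromℕ< i<n))
  off-gap : ∀ {r} → r ≢ k → toℕ r ≢ i
  off-gap r≢k r≡i = r≢k (toℕ-injective (trans r≡i (sym (toℕ-fromℕ< i<n))))
  R₁-off : ∀ r → r ≢ k → R₁ r ≗ minor (rowDifferences M) zero r
  R₁-off r r≢k s = sym (trans (entry r s) (binomDifference-off n x i (c s) r (off-gap r≢k)))
  R₂-off : ∀ r → r ≢ k → R₂ r ≗ minor (rowDifferences M) zero r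
  R₂-off r r≢k s = trans (cong (λ p → + (p C c s)) (sym (omitRow-off n x i r (off-gap r≢k)))) (R₁-off r r≢k s)
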